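{- Let $s(n)=\sum_{d\mid n,\ d<n} d$ denote the sum of the proper positive divisors of $n$, and let $S_s(n)=\sum_{d\mid n} s(d)$. Then the set of values $\{S_s(n)/n : n\in\mathbb{N}\}$ is dense in the interval $[0,\infty)$.
   Context: All divisors are positive divisors.
   Formalization: Density in $[0,\infty)$ is tested only on open intervals with rational endpoints, each required to contain some value $S_s(n)/n$. -}

module Defs where

open import Data.Nat using (ℕ; suc; _<?_)
open import Data.Nat.Divisibility using (_∣?_)
open import Data.List using (List; filter; map; upTo)
open import Data.Nat.ListAction using (sum)
open import Data.Integer using (+_)
open import Data.Rational using (ℚ; _/_)

-- positive divisors of n, i.e. the d with 1 ≤ d ≤ n and d ∣ n (empty for n = 0)
divisors : ℕ → List ℕ
divisors n = filter (_∣? n) (map suc (upTo n))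

s : ℕ → ℕ
s n = sum (filter (_<? n) (divisors n))

Ss : ℕ → ℕ
Ss n = sum (map s (divisors n))

-- the value S_s(n)/n as a rational, for n = suc m ≥ 1
ratio : ℕ → ℚ
ratio m = (+ Ss (suc m)) / suc m

-- For a prime p ∤ m the divisor sums are multiplicative in p: σ(pm) = (1+p)σ(m) and
-- Σ_{d∣pm} σ(d) = (2+p) Σ_{d∣m} σ(d).  Since Ss(n) + σ(n) = Σ_{d∣n} σ(d), this gives
-- Ss(pm) = (2+p) Ss(m) + σ(m), so multiplying by a large prime moves Ss(m)/m only a little
-- while Ss(m)/m stays bounded.
--
-- Given a < b, let n be the product of the primes in (M, Y], with M large in terms of a and b.
-- Euler's argument, H_Y ≤ ∏_{p ≤ Y} p/(p-1) ≤ 2^M (σ(n)/n)², makes Ss(n)/n ≥ σ(n)/n - 1 > a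
-- once Y is large.  Removing the primes of n one at a time, largest first, ends at
-- Ss(1)/1 = 0 ≤ a; the last product whose ratio still exceeds a has ratio below b.

module Submission where

open import Algebra.Bundles using (CommutativeSemigroup)
open import Algebra.Core using (Op₂)
open import Algebra.Structures using (IsCommutativeSemiring)
open import Data.Empty using (⊥-elim)
open import Data.List.Base using (List; []; _∷_; _++_; [_]; filter; map; upTo)
open import Data.List.Membership.Propositional using (_∈_)
open import Data.List.Properties
  using (upTo-∷ʳ; map-++; map-id; filter-++; filter-accept; filter-reject; filter-all; ++-identityʳ)
open import Data.List.Relation.Unary.All as All using (All; []; _∷_)
import Data.List.Relation.Unary.All.Properties as All
open import Data.List.Relation.Unary.AllPairs using (AllPairs; []; _∷_)
open import Data.List.Relation.Unary.Any using (here; there)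
open import Data.Nat.Base as ℕ using (ℕ; zero; suc; NonZero; >-nonZero; z≤n; s≤s)
import Data.Nat.Properties as ℕ
open import Data.Nat.Coprimality using (Coprime; coprime-divisor)
import Data.Nat.Coprimality as Coprime
open import Data.Nat.Divisibility
  using (_∣_; _∣?_; divides; ∣-refl; ∣-trans; ∣⇒≤; m∣m*n; n∣m*n; m≤n⇒m!∣n!; 0∣⇒≡0; ∣m+n∣m⇒∣n;
         *-cancelˡ-∣; *-monoʳ-∣)
open import Data.Nat.Induction using (<-rec)
open import Data.Nat.ListAction using (sum; product)
open import Data.Nat.ListAction.Properties using (sum-++)
open import Data.Nat.Primality
  using (Prime; prime?; prime⇒irreducible; prime⇒nonZero; prime⇒nonTrivial; euclidsLemma; productOfPrimes≢0)
open import Data.Nat.Primality.Factorisation using (factorise; factorisationHasAllPrimeFactors)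
open import Data.Nat.Tactic.RingSolver using (solve-∀)
open import Data.Product using (_×_; _,_; ∃; ∃₂; ∃-syntax; proj₁; proj₂; uncurry)
import Data.Rational.Properties as ℚ
open import Data.Sum using (inj₁; inj₂)
open import Function.Base using (_∘_; id)
open import Level using (0ℓ)
open import Relation.Binary.PropositionalEquality hiding ([_])
open import Relation.Nullary using (Dec; yes; no; ¬_)
open import Relation.Nullary.Decidable using (_×-dec_)
open import Relation.Unary using (Decidable)

open import Defs

module Primes where
  open import Data.Nat using (_*_; _^_; _≤_; _<_; _>_; _!; _<?_)

  prime>1 : ∀ {p} → Prime p → 1 < p
  prime>1 {p} p-prime = ℕ.nonTrivial⇒n>1 p {{prime⇒nonTrivial p-prime}}

  prime∤⇒coprime : ∀ {p n} → Prime p → ¬ p ∣ n → Coprime p n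
  prime∤⇒coprime p-prime p∤n (d∣p , d∣n) with prime⇒irreducible p-prime d∣p
  ... | inj₁ d≡1 = d≡1
  ... | inj₂ refl = ⊥-elim (p∤n d∣n)

  ∣p^e*m⇒∣m : ∀ {p d m} e → Prime p → ¬ p ∣ d → d ∣ p ^ e * m → d ∣ m
  ∣p^e*m⇒∣m {m = m} zero _ _ d∣m = subst (_ ∣_) (ℕ.*-identityˡ m) d∣m
  ∣p^e*m⇒∣m {p} {d} {m} (suc e) p-prime p∤d d∣ = ∣p^e*m⇒∣m e p-prime p∤d
    (coprime-divisor (Coprime.sym (prime∤⇒coprime p-prime p∤d)) (subst (d ∣_) (ℕ.*-assoc p (p ^ e) m) d∣))

  prime∤product : ∀ {q rs} → Prime q → All Prime rs → All (_< q) rs → ¬ q ∣ product rs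
  prime∤product q-prime rs-prime rs<q q∣ =
    ℕ.<-irrefl refl (All.lookup rs<q (factorisationHasAllPrimeFactors q-prime q∣ rs-prime))

  factorOut : ∀ {p} → Prime p → ∀ n → .{{NonZero n}} → ∃₂ λ e m → n ≡ p ^ e * m × ¬ p ∣ m
  factorOut {p} p-prime n = <-rec Factorable step n
    where
    Factorable : ℕ → Set
    Factorable n = .{{NonZero n}} → ∃₂ λ e m → n ≡ p ^ e * m × ¬ p ∣ m
    step : ∀ n → (∀ {k} → k < n → Factorable k) → Factorable n
    step n rec {{n≢0}} with p ∣? n
    ... | no  p∤n = 0 , n , sym (ℕ.*-identityˡ n) , p∤n
    ... | yes (divides k n≡k*p) with rec k<n {{k≢0}}
      where
      k≢0 : NonZero k
      k≢0 = ℕ.m*n≢0⇒m≢0 k {{subst NonZero n≡k*p n≢0}}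
      k<n : k < n
      k<n = subst (k <_) (sym n≡k*p) (ℕ.m<m*n k p {{k≢0}} (prime>1 p-prime))
    ...   | e , m , k≡p^e*m , p∤m = suc e , m , n≡ , p∤m
      where
      n≡ : n ≡ p ^ suc e * m
      n≡ = begin
        n                ≡⟨ n≡k*p ⟩
        k * p            ≡⟨ ℕ.*-comm k p ⟩
        p * k            ≡⟨ cong (p *_) k≡p^e*m ⟩
        p * (p ^ e * m)  ≡⟨ ℕ.*-assoc p (p ^ e) m ⟨
        p ^ suc e * m    ∎
        where open ≡-Reasoning

  divisor≢0 : ∀ {d n} .{{_ : NonZero n}} → d ∣ n → NonZero d
  divisor≢0 {zero}  {n} 0∣n = ⊥-elim (ℕ.≢-nonZero⁻¹ n (0∣⇒≡0 0∣n))
  divisor≢0 {suc _}     _   = _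

  no-prime-divisor⇒≡1 : ∀ n .{{_ : NonZero n}} → (∀ {r} → Prime r → ¬ r ∣ n) → n ≡ 1
  no-prime-divisor⇒≡1 n no-prime with factorise n
  ... | record { factors = []     ; isFactorisation = n≡1 } = n≡1
  ... | record { factors = r ∷ rs ; isFactorisation = n≡r*rs ; factorsPrime = r-prime ∷ _ } =
    ⊥-elim (no-prime r-prime (subst (r ∣_) (sym n≡r*rs) (m∣m*n (product rs))))

  ∣n! : ∀ {k n} → 1 ≤ k → k ≤ n → k ∣ n !
  ∣n! {suc k} _ k≤n = ∣-trans (m∣m*n (k !)) (m≤n⇒m!∣n! k≤n)

  prime∣n!⇒≤ : ∀ {p} n → Prime p → p ∣ n ! → p ≤ n
  prime∣n!⇒≤ zero    p-prime p∣1 with () ← factorisationHasAllPrimeFactors {[]} p-prime p∣1 []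
  prime∣n!⇒≤ (suc n) p-prime p∣ with euclidsLemma (suc n) (n !) p-prime p∣
  ... | inj₁ p∣1+n = ∣⇒≤ p∣1+n
  ... | inj₂ p∣n!  = ℕ.m≤n⇒m≤1+n (prime∣n!⇒≤ n p-prime p∣n!)

  primesIn : ℕ → ℕ → List ℕ
  primesIn M zero    = []
  primesIn M (suc Y) with M <? suc Y ×-dec prime? (suc Y)
  ... | yes _ = suc Y ∷ primesIn M Y
  ... | no  _ = primesIn M Y

  InRange : ℕ → ℕ → ℕ → Set
  InRange M Y r = Prime r × M < r × r ≤ Y

  InRange-suc : ∀ {M Y r} → InRange M Y r → InRange M (suc Y) r
  InRange-suc (r-prime , M<r , r≤Y) = r-prime , M<r , ℕ.m≤n⇒m≤1+n r≤Y

  primesIn-sound : ∀ M Y → All (InRange M Y) (primesIn M Y)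
  primesIn-sound M zero    = []
  primesIn-sound M (suc Y) with M <? suc Y ×-dec prime? (suc Y)
  ... | yes (M<1+Y , 1+Y-prime) = (1+Y-prime , M<1+Y , ℕ.≤-refl) ∷ All.map InRange-suc (primesIn-sound M Y)
  ... | no  _                   = All.map InRange-suc (primesIn-sound M Y)

  primesIn-complete : ∀ {M r} Y → Prime r → M < r → r ≤ Y → r ∈ primesIn M Y
  primesIn-complete zero _ () z≤n
  primesIn-complete {M} {r} (suc Y) r-prime M<r r≤1+Y with M <? suc Y ×-dec prime? (suc Y) | r ℕ.≟ suc Y
  ... | yes _ | yes refl  = here refl
  ... | no ¬M<∧prime | yes refl = ⊥-elim (¬M<∧prime (M<r , r-prime))
  ... | yes _ | no r≢1+Y = there (primesIn-complete Y r-prime M<r (ℕ.≤-pred (ℕ.≤∧≢⇒< r≤1+Y r≢1+Y)))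
  ... | no  _ | no r≢1+Y = primesIn-complete Y r-prime M<r (ℕ.≤-pred (ℕ.≤∧≢⇒< r≤1+Y r≢1+Y))

  primesIn-decreasing : ∀ M Y → AllPairs _>_ (primesIn M Y)
  primesIn-decreasing M zero    = []
  primesIn-decreasing M (suc Y) with M <? suc Y ×-dec prime? (suc Y)
  ... | yes _ = All.map (λ (_ , _ , r≤Y) → s≤s r≤Y) (primesIn-sound M Y) ∷ primesIn-decreasing M Y
  ... | no  _ = primesIn-decreasing M Y

module DivisorSums
  {A : Set} {_+_ _*_ : Op₂ A} {0# 1# : A}
  (isCommutativeSemiring : IsCommutativeSemiring _≡_ _+_ _*_ 0# 1#) where

  open import Data.Nat.Base using (_^_; _≤_; _<_)
  open Primes using (∣p^e*m⇒∣m)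

  open IsCommutativeSemiring isCommutativeSemiring
    using (+-assoc; +-identityˡ; +-identityʳ; distribˡ; zeroʳ; +-isCommutativeSemigroup)

  private
    +-commutativeSemigroup : CommutativeSemigroup 0ℓ 0ℓ
    +-commutativeSemigroup = record { isCommutativeSemigroup = +-isCommutativeSemigroup }

  open import Algebra.Properties.CommutativeSemigroup +-commutativeSemigroup using (interchange)

  sumTo : ℕ → (ℕ → A) → A
  sumTo zero    f = 0#
  sumTo (suc n) f = sumTo n f + f (suc n)

  when : {P : Set} → Dec P → A → A
  when (yes _) x = x
  when (no _)  _ = 0#

  divisorSum : (ℕ → A) → ℕ → A
  divisorSum f n = sumTo n (λ d → when (d ∣? n) (f d))

  sumTo-cong : ∀ n {f g} → (∀ {d} → 1 ≤ d → d ≤ n → f d ≡ g d) → sumTo n f ≡ sumTo n g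
  sumTo-cong zero    eq = refl
  sumTo-cong (suc n) eq =
    cong₂ _+_ (sumTo-cong n (λ 1≤d d≤n → eq 1≤d (ℕ.m≤n⇒m≤1+n d≤n))) (eq (s≤s z≤n) ℕ.≤-refl)

  sumTo-zero : ∀ n {f} → (∀ {d} → 1 ≤ d → d ≤ n → f d ≡ 0#) → sumTo n f ≡ 0#
  sumTo-zero n {f} f≡0 = trans (sumTo-cong n f≡0) (sumTo-0# n)
    where
    sumTo-0# : ∀ n → sumTo n (λ _ → 0#) ≡ 0#
    sumTo-0# zero    = refl
    sumTo-0# (suc n) = trans (cong (_+ 0#) (sumTo-0# n)) (+-identityʳ 0#)

  sumTo-+ : ∀ n f g → sumTo n (λ d → f d + g d) ≡ sumTo n f + sumTo n g
  sumTo-+ zero    f g = sym (+-identityˡ 0#)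
  sumTo-+ (suc n) f g = begin
    sumTo n (λ d → f d + g d) + (f (suc n) + g (suc n))  ≡⟨ cong (_+ _) (sumTo-+ n f g) ⟩
    (sumTo n f + sumTo n g) + (f (suc n) + g (suc n))    ≡⟨ interchange _ _ _ _ ⟩
    (sumTo n f + f (suc n)) + (sumTo n g + g (suc n))    ∎
    where open ≡-Reasoning

  sumTo-*ˡ : ∀ c n f → sumTo n (λ d → c * f d) ≡ c * sumTo n f
  sumTo-*ˡ c zero    f = sym (zeroʳ c)
  sumTo-*ˡ c (suc n) f = trans (cong (_+ _) (sumTo-*ˡ c n f)) (sym (distribˡ c _ _))

  sumTo-split : ∀ m k f → sumTo (m ℕ.+ k) f ≡ sumTo m f + sumTo k (λ j → f (m ℕ.+ j))
  sumTo-split m zero    f rewrite ℕ.+-identityʳ m = sym (+-identityʳ _)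
  sumTo-split m (suc k) f rewrite ℕ.+-suc m k =
    trans (cong (_+ f (suc (m ℕ.+ k))) (sumTo-split m k f)) (+-assoc _ _ _)

  sumTo-extend : ∀ {m n} f → m ≤ n → (∀ {d} → m < d → d ≤ n → f d ≡ 0#) → sumTo n f ≡ sumTo m f
  sumTo-extend {m} {n} f m≤n f≡0 = begin
    sumTo n f                                        ≡⟨ cong (λ k → sumTo k f) (sym (ℕ.m+[n∸m]≡n m≤n)) ⟩
    sumTo (m ℕ.+ (n ℕ.∸ m)) f                        ≡⟨ sumTo-split m (n ℕ.∸ m) f ⟩
    sumTo m f + sumTo (n ℕ.∸ m) (λ j → f (m ℕ.+ j))  ≡⟨ cong (sumTo m f +_) (sumTo-zero (n ℕ.∸ m) tail≡0) ⟩
    sumTo m f + 0#                                   ≡⟨ +-identityʳ _ ⟩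
    sumTo m f                                        ∎
    where
    open ≡-Reasoning
    tail≡0 : ∀ {j} → 1 ≤ j → j ≤ n ℕ.∸ m → f (m ℕ.+ j) ≡ 0#
    tail≡0 {j} 1≤j j≤ = f≡0 (subst (_≤ m ℕ.+ j) (ℕ.+-comm m 1) (ℕ.+-monoʳ-≤ m 1≤j))
                            (subst (m ℕ.+ j ≤_) (ℕ.m+[n∸m]≡n m≤n) (ℕ.+-monoʳ-≤ m j≤))

  sumTo-multiples : ∀ p .{{_ : NonZero p}} K (g : ℕ → A) →
    sumTo (p ℕ.* K) (λ d → when (p ∣? d) (g d)) ≡ sumTo K (λ e → g (p ℕ.* e))
  sumTo-multiples p@(suc p-1) zero    g rewrite ℕ.*-zeroʳ p = refl
  sumTo-multiples p@(suc p-1) (suc K) g = begin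
    sumTo (p ℕ.* suc K) G                                  ≡⟨ cong (λ n → sumTo n G) pK+p≡p[1+K] ⟨
    sumTo (p ℕ.* K ℕ.+ p) G                                ≡⟨ sumTo-split (p ℕ.* K) p G ⟩
    sumTo (p ℕ.* K) G + sumTo p (λ j → G (p ℕ.* K ℕ.+ j))  ≡⟨ cong₂ _+_ (sumTo-multiples p K g) lastBlock ⟩
    sumTo K (λ e → g (p ℕ.* e)) + g (p ℕ.* suc K)          ∎
    where
    open ≡-Reasoning
    G = λ d → when (p ∣? d) (g d)
    pK+p≡p[1+K] : p ℕ.* K ℕ.+ p ≡ p ℕ.* suc K
    pK+p≡p[1+K] = trans (ℕ.+-comm (p ℕ.* K) p) (sym (ℕ.*-suc p K))
    inner≡0 : ∀ {j} → 1 ≤ j → j ≤ p-1 → G (p ℕ.* K ℕ.+ j) ≡ 0#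
    inner≡0 {j} 1≤j j<p with p ∣? (p ℕ.* K ℕ.+ j)
    ... | yes p∣ = ⊥-elim (ℕ.<⇒≱ (s≤s j<p) (∣⇒≤ {{>-nonZero 1≤j}} (∣m+n∣m⇒∣n p∣ (m∣m*n K))))
    ... | no  _  = refl
    last≡ : G (p ℕ.* K ℕ.+ p) ≡ g (p ℕ.* suc K)
    last≡ rewrite pK+p≡p[1+K] with p ∣? (p ℕ.* suc K)
    ... | yes _  = refl
    ... | no  p∤ = ⊥-elim (p∤ (m∣m*n (suc K)))
    lastBlock : sumTo p (λ j → G (p ℕ.* K ℕ.+ j)) ≡ g (p ℕ.* suc K)
    lastBlock = trans (cong₂ _+_ (sumTo-zero p-1 inner≡0) last≡) (+-identityˡ _)

  when-cong : ∀ {P Q : Set} (P? : Dec P) (Q? : Dec Q) x → (P → Q) → (Q → P) → when P? x ≡ when Q? x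
  when-cong (yes _) (yes _) x _   _   = refl
  when-cong (no  _) (no  _) x _   _   = refl
  when-cong (yes p) (no ¬q) x p→q _   = ⊥-elim (¬q (p→q p))
  when-cong (no ¬p) (yes q) x _   q→p = ⊥-elim (¬p (q→p q))

  divisorSum-cong : ∀ n {f g} → (∀ {d} → d ∣ n → f d ≡ g d) → divisorSum f n ≡ divisorSum g n
  divisorSum-cong n {f} {g} eq = sumTo-cong n (λ {d} _ _ → pointwise d)
    where
    pointwise : ∀ d → when (d ∣? n) (f d) ≡ when (d ∣? n) (g d)
    pointwise d with d ∣? n
    ... | yes d∣n = eq d∣n
    ... | no  _   = refl

  divisorSum-+ : ∀ n f g → divisorSum (λ d → f d + g d) n ≡ divisorSum f n + divisorSum g n
  divisorSum-+ n f g = trans (sumTo-cong n (λ {d} _ _ → pointwise d)) (sumTo-+ n _ _)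
    where
    pointwise : ∀ d → when (d ∣? n) (f d + g d) ≡ when (d ∣? n) (f d) + when (d ∣? n) (g d)
    pointwise d with d ∣? n
    ... | yes _ = refl
    ... | no  _ = sym (+-identityˡ 0#)

  divisorSum-*ˡ : ∀ c n f → divisorSum (λ d → c * f d) n ≡ c * divisorSum f n
  divisorSum-*ˡ c n f = trans (sumTo-cong n (λ {d} _ _ → pointwise d)) (sumTo-*ˡ c n _)
    where
    pointwise : ∀ d → when (d ∣? n) (c * f d) ≡ c * when (d ∣? n) (f d)
    pointwise d with d ∣? n
    ... | yes _ = refl
    ... | no  _ = sym (zeroʳ c)

  divisorSum-split : ∀ {p m} e (f : ℕ → A) → Prime p → ¬ p ∣ m → .{{_ : NonZero m}} →
    divisorSum f (p ℕ.* (p ^ e ℕ.* m)) ≡ divisorSum (λ d → f (p ℕ.* d)) (p ^ e ℕ.* m) + divisorSum f m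
  divisorSum-split {p} {m} e f p-prime p∤m = begin
    sumTo (p ℕ.* K) t
      ≡⟨ sumTo-cong (p ℕ.* K) (λ {d} _ _ → separate d) ⟩
    sumTo (p ℕ.* K) (λ d → when (p ∣? d) (t d) + when (d ∣? m) (f d))
      ≡⟨ sumTo-+ (p ℕ.* K) _ _ ⟩
    sumTo (p ℕ.* K) (λ d → when (p ∣? d) (t d)) + sumTo (p ℕ.* K) (λ d → when (d ∣? m) (f d))
      ≡⟨ cong₂ _+_ (sumTo-multiples p K t) (sumTo-extend _ m≤pK beyond-m) ⟩
    sumTo K (λ e → t (p ℕ.* e)) + divisorSum f m
      ≡⟨ cong (_+ divisorSum f m) (sumTo-cong K (λ {e} _ _ → cancel e)) ⟩
    divisorSum (λ d → f (p ℕ.* d)) K + divisorSum f m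
      ∎
    where
    open ≡-Reasoning
    instance
      p≢0 = prime⇒nonZero p-prime
      K≢0 : NonZero (p ^ e ℕ.* m)
      K≢0 = ℕ.m*n≢0 (p ^ e) m {{ℕ.m^n≢0 p e}}
      pK≢0 : NonZero (p ℕ.* (p ^ e ℕ.* m))
      pK≢0 = ℕ.m*n≢0 p _
    K = p ^ e ℕ.* m
    t = λ d → when (d ∣? p ℕ.* K) (f d)
    m∣pK : m ∣ p ℕ.* K
    m∣pK = ∣-trans (n∣m*n (p ^ e)) (n∣m*n p)
    m≤pK : m ≤ p ℕ.* K
    m≤pK = ∣⇒≤ m∣pK
    beyond-m : ∀ {d} → m < d → d ≤ p ℕ.* K → when (d ∣? m) (f d) ≡ 0#
    beyond-m {d} m<d _ with d ∣? m
    ... | yes d∣m = ⊥-elim (ℕ.<⇒≱ m<d (∣⇒≤ d∣m))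
    ... | no  _   = refl
    separate : ∀ d → t d ≡ when (p ∣? d) (t d) + when (d ∣? m) (f d)
    separate d with p ∣? d
    separate d | yes p∣d with d ∣? m
    ... | yes d∣m = ⊥-elim (p∤m (∣-trans p∣d d∣m))
    ... | no  _   = sym (+-identityʳ _)
    separate d | no p∤d =
      trans (when-cong (d ∣? p ℕ.* K) (d ∣? m) (f d) ∣pK⇒∣m (λ d∣m → ∣-trans d∣m m∣pK)) (sym (+-identityˡ _))
      where
      ∣pK⇒∣m : d ∣ p ℕ.* K → d ∣ m
      ∣pK⇒∣m = ∣p^e*m⇒∣m (suc e) p-prime p∤d ∘ subst (d ∣_) (sym (ℕ.*-assoc p (p ^ e) m))
    cancel : ∀ e → t (p ℕ.* e) ≡ when (e ∣? K) (f (p ℕ.* e))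
    cancel e = when-cong (p ℕ.* e ∣? p ℕ.* K) (e ∣? K) _ (*-cancelˡ-∣ p) (*-monoʳ-∣ p)

  divisorSum-*-prime : ∀ {p m} (f : ℕ → A) → Prime p → ¬ p ∣ m → .{{_ : NonZero m}} →
    divisorSum f (p ℕ.* m) ≡ divisorSum (λ d → f (p ℕ.* d)) m + divisorSum f m
  divisorSum-*-prime {p} {m} f p-prime p∤m =
    subst (λ k → divisorSum f (p ℕ.* k) ≡ divisorSum (λ d → f (p ℕ.* d)) k + divisorSum f m)
          (ℕ.*-identityˡ m) (divisorSum-split 0 f p-prime p∤m)

module DivisorFunctions where
  open import Data.Nat using (_+_; _*_; _≤_; _<_; _>_; _<?_)
  open Primes using (divisor≢0; prime∤product)
  open DivisorSums ℕ.+-*-isCommutativeSemiring public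

  sum-map-filter : ∀ {P : ℕ → Set} (P? : Decidable P) (f : ℕ → ℕ) xs →
    sum (map f (filter P? xs)) ≡ sum (map (λ x → when (P? x) (f x)) xs)
  sum-map-filter P? f []       = refl
  sum-map-filter P? f (x ∷ xs) with P? x
  ... | yes _ = cong (f x +_) (sum-map-filter P? f xs)
  ... | no  _ = sum-map-filter P? f xs

  sum-map-range : ∀ (f : ℕ → ℕ) n → sum (map f (map suc (upTo n))) ≡ sumTo n f
  sum-map-range f zero    = refl
  sum-map-range f (suc n) = begin
    sum (map f (map suc (upTo (suc n))))              ≡⟨ cong (sum ∘ map f ∘ map suc) (upTo-∷ʳ n) ⟨
    sum (map f (map suc (upTo n ++ [ n ])))           ≡⟨ cong (sum ∘ map f) (map-++ suc (upTo n) [ n ]) ⟩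
    sum (map f (map suc (upTo n) ++ [ suc n ]))       ≡⟨ cong sum (map-++ f (map suc (upTo n)) [ suc n ]) ⟩
    sum (map f (map suc (upTo n)) ++ [ f (suc n) ])   ≡⟨ sum-++ (map f (map suc (upTo n))) [ f (suc n) ] ⟩
    sum (map f (map suc (upTo n))) + (f (suc n) + 0)  ≡⟨ cong₂ _+_ (sum-map-range f n) (ℕ.+-identityʳ _) ⟩
    sumTo n f + f (suc n)                             ∎
    where open ≡-Reasoning

  sum-map-divisors : ∀ (f : ℕ → ℕ) n → sum (map f (divisors n)) ≡ divisorSum f n
  sum-map-divisors f n = trans (sum-map-filter (_∣? n) f (map suc (upTo n))) (sum-map-range _ n)

  σ : ℕ → ℕ
  σ = divisorSum id

  sum-divisors : ∀ n → sum (divisors n) ≡ σ n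
  sum-divisors n = trans (cong sum (sym (map-id (divisors n)))) (sum-map-divisors id n)

  divisors-suc : ∀ k → divisors (suc k) ≡ filter (_∣? suc k) (map suc (upTo k)) ++ [ suc k ]
  divisors-suc k = begin
    filter (_∣? suc k) (map suc (upTo (suc k)))
      ≡⟨ cong (filter (_∣? suc k) ∘ map suc) (upTo-∷ʳ k) ⟨
    filter (_∣? suc k) (map suc (upTo k ++ [ k ]))
      ≡⟨ cong (filter (_∣? suc k)) (map-++ suc (upTo k) [ k ]) ⟩
    filter (_∣? suc k) (map suc (upTo k) ++ [ suc k ])
      ≡⟨ filter-++ (_∣? suc k) (map suc (upTo k)) [ suc k ] ⟩
    filter (_∣? suc k) (map suc (upTo k)) ++ filter (_∣? suc k) [ suc k ]
      ≡⟨ cong (filter (_∣? suc k) (map suc (upTo k)) ++_) (filter-accept (_∣? suc k) ∣-refl) ⟩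
    filter (_∣? suc k) (map suc (upTo k)) ++ [ suc k ] ∎
    where open ≡-Reasoning

  properDivisors-suc : ∀ k → filter (_<? suc k) (divisors (suc k)) ≡ filter (_∣? suc k) (map suc (upTo k))
  properDivisors-suc k = begin
    filter (_<? suc k) (divisors (suc k))
      ≡⟨ cong (filter (_<? suc k)) (divisors-suc k) ⟩
    filter (_<? suc k) (ds ++ [ suc k ])
      ≡⟨ filter-++ (_<? suc k) ds [ suc k ] ⟩
    filter (_<? suc k) ds ++ filter (_<? suc k) [ suc k ]
      ≡⟨ cong₂ _++_ (filter-all (_<? suc k) ds<1+k) (filter-reject (_<? suc k) (ℕ.<-irrefl refl)) ⟩
    ds ++ []
      ≡⟨ ++-identityʳ ds ⟩
    ds ∎
    where
    open ≡-Reasoning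
    ds = filter (_∣? suc k) (map suc (upTo k))
    ds<1+k : All (_< suc k) ds
    ds<1+k = All.filter⁺ (_∣? suc k) (All.map⁺ (All.applyUpTo⁺₁ id k s≤s))

  s+n≡σ : ∀ n → s n + n ≡ σ n
  s+n≡σ zero    = refl
  s+n≡σ (suc k) = begin
    sum (filter (_<? suc k) (divisors (suc k))) + suc k  ≡⟨ cong (λ xs → sum xs + suc k) (properDivisors-suc k) ⟩
    sum ds + suc k                                       ≡⟨ cong (sum ds +_) (ℕ.+-identityʳ (suc k)) ⟨
    sum ds + sum [ suc k ]                               ≡⟨ sum-++ ds [ suc k ] ⟨
    sum (ds ++ [ suc k ])                                ≡⟨ cong sum (divisors-suc k) ⟨
    sum (divisors (suc k))                               ≡⟨ sum-divisors (suc k) ⟩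
    σ (suc k)                                            ∎
    where
    open ≡-Reasoning
    ds = filter (_∣? suc k) (map suc (upTo k))

  s≤Ss : ∀ n → s n ≤ Ss n
  s≤Ss zero    = z≤n
  s≤Ss (suc k) = begin
    s (suc k)                           ≤⟨ ℕ.m≤n+m (s (suc k)) (sum (map s ds)) ⟩
    sum (map s ds) + s (suc k)          ≡⟨ cong (sum (map s ds) +_) (ℕ.+-identityʳ _) ⟨
    sum (map s ds) + sum [ s (suc k) ]  ≡⟨ sum-++ (map s ds) [ s (suc k) ] ⟨
    sum (map s ds ++ [ s (suc k) ])     ≡⟨ cong sum (map-++ s ds [ suc k ]) ⟨
    sum (map s (ds ++ [ suc k ]))       ≡⟨ cong (sum ∘ map s) (divisors-suc k) ⟨
    Ss (suc k)                          ∎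
    where
    open ℕ.≤-Reasoning
    ds = filter (_∣? suc k) (map suc (upTo k))

  σ≤Ss+n : ∀ n → σ n ≤ Ss n + n
  σ≤Ss+n n = subst (_≤ Ss n + n) (s+n≡σ n) (ℕ.+-monoˡ-≤ n (s≤Ss n))

  Ss+σ≡divisorSum-σ : ∀ n → Ss n + σ n ≡ divisorSum σ n
  Ss+σ≡divisorSum-σ n = begin
    Ss n + σ n                        ≡⟨ cong (_+ σ n) (sum-map-divisors s n) ⟩
    divisorSum s n + divisorSum id n  ≡⟨ divisorSum-+ n s id ⟨
    divisorSum (λ d → s d + d) n      ≡⟨ divisorSum-cong n (λ {d} _ → s+n≡σ d) ⟩
    divisorSum σ n                    ∎
    where open ≡-Reasoning

  σ-*-prime : ∀ {p m} → Prime p → ¬ p ∣ m → .{{_ : NonZero m}} → σ (p * m) ≡ (1 + p) * σ m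
  σ-*-prime {p} {m} p-prime p∤m = begin
    σ (p * m)                  ≡⟨ divisorSum-*-prime id p-prime p∤m ⟩
    divisorSum (p *_) m + σ m  ≡⟨ cong (_+ σ m) (divisorSum-*ˡ p m id) ⟩
    p * σ m + σ m              ≡⟨ ℕ.+-comm (p * σ m) (σ m) ⟩
    (1 + p) * σ m              ∎
    where open ≡-Reasoning

  divisorSum-σ-*-prime : ∀ {p m} → Prime p → ¬ p ∣ m → .{{_ : NonZero m}} →
    divisorSum σ (p * m) ≡ (2 + p) * divisorSum σ m
  divisorSum-σ-*-prime {p} {m} p-prime p∤m = begin
    divisorSum σ (p * m)                    ≡⟨ divisorSum-*-prime σ p-prime p∤m ⟩
    divisorSum (λ d → σ (p * d)) m + F      ≡⟨ cong (_+ F) (divisorSum-cong m σ-*-p-at-divisor) ⟩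
    divisorSum (λ d → (1 + p) * σ d) m + F  ≡⟨ cong (_+ F) (divisorSum-*ˡ (1 + p) m σ) ⟩
    (1 + p) * F + F                         ≡⟨ ℕ.+-comm ((1 + p) * F) F ⟩
    (2 + p) * F                             ∎
    where
    open ≡-Reasoning
    F = divisorSum σ m
    σ-*-p-at-divisor : ∀ {d} → d ∣ m → σ (p * d) ≡ (1 + p) * σ d
    σ-*-p-at-divisor d∣m = σ-*-prime p-prime (λ p∣d → p∤m (∣-trans p∣d d∣m)) {{divisor≢0 d∣m}}

  Ss-*-prime : ∀ {p m} → Prime p → ¬ p ∣ m → .{{_ : NonZero m}} → Ss (p * m) ≡ (2 + p) * Ss m + σ m
  Ss-*-prime {p} {m} p-prime p∤m = ℕ.+-cancelʳ-≡ ((1 + p) * σ m) _ _ (begin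
    Ss (p * m) + (1 + p) * σ m            ≡⟨ cong (Ss (p * m) +_) (σ-*-prime p-prime p∤m) ⟨
    Ss (p * m) + σ (p * m)                ≡⟨ Ss+σ≡divisorSum-σ (p * m) ⟩
    divisorSum σ (p * m)                  ≡⟨ divisorSum-σ-*-prime p-prime p∤m ⟩
    (2 + p) * divisorSum σ m              ≡⟨ cong ((2 + p) *_) (Ss+σ≡divisorSum-σ m) ⟨
    (2 + p) * (Ss m + σ m)                ≡⟨ regroup p (Ss m) (σ m) ⟩
    (2 + p) * Ss m + σ m + (1 + p) * σ m  ∎)
    where
    open ≡-Reasoning
    regroup : ∀ p x y → (2 + p) * (x + y) ≡ (2 + p) * x + y + (1 + p) * y
    regroup = solve-∀

  σ-product : ∀ {qs} → All Prime qs → AllPairs _>_ qs → σ (product qs) ≡ product (map suc qs)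
  σ-product []                   []                 = refl
  σ-product {q ∷ qs} (q-prime ∷ qs-prime) (qs<q ∷ qs-decreasing) = begin
    σ (q * product qs)          ≡⟨ σ-*-prime q-prime (prime∤product q-prime qs-prime qs<q) {{productOfPrimes≢0 qs-prime}} ⟩
    suc q * σ (product qs)      ≡⟨ cong (suc q *_) (σ-product qs-prime qs-decreasing) ⟩
    product (map suc (q ∷ qs))  ∎
    where open ≡-Reasoning

  SsRatioBetween : ℕ → ℕ → ℕ → ℕ → ℕ → Set
  SsRatioBetween α β γ δ n = α * n < Ss n * β × Ss n * δ < γ * n

module NaturalFractions where
  open import Data.Rational as ℚ using (ℚ; 0ℚ; 1ℚ; 1/_; _+_; _*_; _≤_; _<_; Positive; positive; nonNegative)
  open import Algebra.Bundles using (CommutativeMonoid; CommutativeRing)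
  open import Algebra.Properties.Semiring.Mult (CommutativeRing.semiring ℚ.+-*-commutativeRing)
    using (×-homo-+; ×1-homo-*) renaming (_×_ to _·_)
  open import Algebra.Properties.CommutativeSemigroup
    (CommutativeMonoid.commutativeSemigroup ℚ.*-1-commutativeMonoid)
    using (interchange; x∙yz≈y∙xz; xy∙z≈x∙zy; xy∙z≈y∙xz)

  ι : ℕ → ℚ
  ι n = n · 1ℚ

  ι-+ : ∀ m n → ι (m ℕ.+ n) ≡ ι m + ι n
  ι-+ = ×-homo-+ 1ℚ

  ι-* : ∀ m n → ι (m ℕ.* n) ≡ ι m * ι n
  ι-* = ×1-homo-*

  ι-nonNeg : ∀ n → 0ℚ ≤ ι n
  ι-nonNeg zero    = ℚ.≤-refl
  ι-nonNeg (suc n) = ℚ.+-mono-≤ (ℚ.nonNegative⁻¹ 1ℚ) (ι-nonNeg n)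

  ι-pos : ∀ n .{{_ : NonZero n}} → 0ℚ < ι n
  ι-pos (suc n) = ℚ.+-mono-<-≤ (ℚ.positive⁻¹ 1ℚ) (ι-nonNeg n)

  ι-nonZero : ∀ n .{{_ : NonZero n}} → ℚ.NonZero (ι n)
  ι-nonZero n = ℚ.pos⇒nonZero (ι n) {{positive (ι-pos n)}}

  ι-mono-≤ : ∀ {m n} → m ℕ.≤ n → ι m ≤ ι n
  ι-mono-≤ {m} {n} m≤n = begin
    ι m                  ≡⟨ ℚ.+-identityʳ (ι m) ⟨
    ι m + 0ℚ             ≤⟨ ℚ.+-monoʳ-≤ (ι m) (ι-nonNeg (n ℕ.∸ m)) ⟩
    ι m + ι (n ℕ.∸ m)    ≡⟨ ι-+ m (n ℕ.∸ m) ⟨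
    ι (m ℕ.+ (n ℕ.∸ m))  ≡⟨ cong ι (ℕ.m+[n∸m]≡n m≤n) ⟩
    ι n                  ∎
    where open ℚ.≤-Reasoning

  ι-mono-< : ∀ {m n} → m ℕ.< n → ι m < ι n
  ι-mono-< {m} {suc n} (s≤s m≤n) = begin-strict
    ι m       ≡⟨ ℚ.+-identityˡ (ι m) ⟨
    0ℚ + ι m  <⟨ ℚ.+-mono-<-≤ (ℚ.positive⁻¹ 1ℚ) (ι-mono-≤ m≤n) ⟩
    1ℚ + ι n  ∎
    where open ℚ.≤-Reasoning

  ι-cancel-< : ∀ {m n} → ι m < ι n → m ℕ.< n
  ι-cancel-< {m} {n} ιm<ιn with m ℕ.<? n
  ... | yes m<n = m<n
  ... | no  m≮n = ⊥-elim (ℚ.<-irrefl refl (ℚ.<-≤-trans ιm<ιn (ι-mono-≤ (ℕ.≮⇒≥ m≮n))))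

  *-mono-≤-nonNeg : ∀ {p q r s} → 0ℚ ≤ q → 0ℚ ≤ r → p ≤ r → q ≤ s → p * q ≤ r * s
  *-mono-≤-nonNeg {q = q} {r} 0≤q 0≤r p≤r q≤s = ℚ.≤-trans
    (ℚ.*-monoʳ-≤-nonNeg q {{nonNegative 0≤q}} p≤r) (ℚ.*-monoˡ-≤-nonNeg r {{nonNegative 0≤r}} q≤s)

  *-nonNeg : ∀ {p q} → 0ℚ ≤ p → 0ℚ ≤ q → 0ℚ ≤ p * q
  *-nonNeg {p} {q} 0≤p 0≤q = ℚ.nonNegative⁻¹ (p * q)
    {{ℚ.nonNeg*nonNeg⇒nonNeg p {{nonNegative 0≤p}} q {{nonNegative 0≤q}}}}

  inv : ℕ → ℚ
  inv zero      = 0ℚ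
  inv n@(suc _) = (1/ ι n) {{ι-nonZero n}}

  ι*inv : ∀ n .{{_ : NonZero n}} → ι n * inv n ≡ 1ℚ
  ι*inv n@(suc _) = ℚ.*-inverseʳ (ι n) {{ι-nonZero n}}

  inv-nonNeg : ∀ n → 0ℚ ≤ inv n
  inv-nonNeg zero      = ℚ.≤-refl
  inv-nonNeg n@(suc _) = ℚ.<⇒≤ (ℚ.positive⁻¹ (inv n) {{ℚ.1/pos⇒pos (ι n) {{positive (ι-pos n)}}}})

  inv-unique : ∀ n .{{_ : NonZero n}} {x} → ι n * x ≡ 1ℚ → x ≡ inv n
  inv-unique n {x} ιn*x≡1 = begin
    x                  ≡⟨ ℚ.*-identityˡ x ⟨
    1ℚ * x             ≡⟨ cong (_* x) (trans (ℚ.*-comm (inv n) (ι n)) (ι*inv n)) ⟨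
    inv n * ι n * x    ≡⟨ ℚ.*-assoc (inv n) (ι n) x ⟩
    inv n * (ι n * x)  ≡⟨ cong (inv n *_) ιn*x≡1 ⟩
    inv n * 1ℚ         ≡⟨ ℚ.*-identityʳ (inv n) ⟩
    inv n              ∎
    where open ≡-Reasoning

  inv-* : ∀ m n → inv (m ℕ.* n) ≡ inv m * inv n
  inv-* zero        n         = sym (ℚ.*-zeroˡ (inv n))
  inv-* m@(suc m-1) zero      = trans (cong inv (ℕ.*-zeroʳ m)) (sym (ℚ.*-zeroʳ (inv m)))
  inv-* m@(suc _)   n@(suc _) = sym (inv-unique (m ℕ.* n) {{ℕ.m*n≢0 m n}} (begin
    ι (m ℕ.* n) * (inv m * inv n)  ≡⟨ cong (_* (inv m * inv n)) (ι-* m n) ⟩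
    ι m * ι n * (inv m * inv n)    ≡⟨ interchange (ι m) (ι n) (inv m) (inv n) ⟩
    ι m * inv m * (ι n * inv n)    ≡⟨ cong₂ _*_ (ι*inv m) (ι*inv n) ⟩
    1ℚ * 1ℚ                        ≡⟨ ℚ.*-identityˡ 1ℚ ⟩
    1ℚ                             ∎))
    where open ≡-Reasoning

  _÷_ : ℕ → ℕ → ℚ
  a ÷ b = ι a * inv b

  ÷-nonNeg : ∀ a b → 0ℚ ≤ a ÷ b
  ÷-nonNeg a b = *-nonNeg (ι-nonNeg a) (inv-nonNeg b)

  ÷*ι : ∀ a b .{{_ : NonZero b}} → a ÷ b * ι b ≡ ι a
  ÷*ι a b = begin
    ι a * inv b * ι b    ≡⟨ ℚ.*-assoc (ι a) (inv b) (ι b) ⟩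
    ι a * (inv b * ι b)  ≡⟨ cong (ι a *_) (trans (ℚ.*-comm (inv b) (ι b)) (ι*inv b)) ⟩
    ι a * 1ℚ             ≡⟨ ℚ.*-identityʳ (ι a) ⟩
    ι a                  ∎
    where open ≡-Reasoning

  ÷-mono-≤ : ∀ a b c d .{{_ : NonZero b}} .{{_ : NonZero d}} → a ℕ.* d ℕ.≤ c ℕ.* b → a ÷ b ≤ c ÷ d
  ÷-mono-≤ a b c d ad≤cb = ℚ.*-cancelʳ-≤-pos (ι b * ι d) {{bd-pos}} (begin
    a ÷ b * (ι b * ι d)  ≡⟨ ℚ.*-assoc (a ÷ b) (ι b) (ι d) ⟨
    a ÷ b * ι b * ι d    ≡⟨ cong (_* ι d) (÷*ι a b) ⟩
    ι a * ι d            ≡⟨ ι-* a d ⟨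
    ι (a ℕ.* d)          ≤⟨ ι-mono-≤ ad≤cb ⟩
    ι (c ℕ.* b)          ≡⟨ ι-* c b ⟩
    ι c * ι b            ≡⟨ cong (_* ι b) (÷*ι c d) ⟨
    c ÷ d * ι d * ι b    ≡⟨ xy∙z≈x∙zy (c ÷ d) (ι d) (ι b) ⟩
    c ÷ d * (ι b * ι d)  ∎)
    where
    open ℚ.≤-Reasoning
    bd-pos : Positive (ι b * ι d)
    bd-pos = ℚ.pos*pos⇒pos (ι b) {{positive (ι-pos b)}} (ι d) {{positive (ι-pos d)}}

  [k*n]÷k≡ι-n : ∀ k n .{{_ : NonZero k}} → (k ℕ.* n) ÷ k ≡ ι n
  [k*n]÷k≡ι-n k n = begin
    ι (k ℕ.* n) * inv k  ≡⟨ cong (_* inv k) (ι-* k n) ⟩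
    ι k * ι n * inv k    ≡⟨ xy∙z≈y∙xz (ι k) (ι n) (inv k) ⟩
    ι n * (ι k * inv k)  ≡⟨ cong (ι n *_) (ι*inv k) ⟩
    ι n * 1ℚ             ≡⟨ ℚ.*-identityʳ (ι n) ⟩
    ι n                  ∎
    where open ≡-Reasoning

  <÷⇒*< : ∀ {a b c} .{{_ : NonZero b}} → ι a < c ÷ b → a ℕ.* b ℕ.< c
  <÷⇒*< {a} {b} {c} ιa<c÷b = ι-cancel-< (begin-strict
    ι (a ℕ.* b)  ≡⟨ ι-* a b ⟩
    ι a * ι b    <⟨ ℚ.*-monoˡ-<-pos (ι b) {{positive (ι-pos b)}} ιa<c÷b ⟩
    c ÷ b * ι b  ≡⟨ ÷*ι c b ⟩
    ι c          ∎)
    where open ℚ.≤-Reasoning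

  1÷n≡inv : ∀ n → 1 ÷ n ≡ inv n
  1÷n≡inv n = trans (cong (_* inv n) (ℚ.+-identityʳ 1ℚ)) (ℚ.*-identityˡ (inv n))

  n÷1≡ι : ∀ n → n ÷ 1 ≡ ι n
  n÷1≡ι n = ℚ.*-identityʳ (ι n)

  inv-antitone : ∀ {m n} .{{_ : NonZero m}} → m ℕ.≤ n → inv n ≤ inv m
  inv-antitone {m} {n} m≤n = subst₂ _≤_ (1÷n≡inv n) (1÷n≡inv m)
    (÷-mono-≤ 1 n 1 m {{ℕ.>-nonZero (ℕ.<-≤-trans (ℕ.>-nonZero⁻¹ m) m≤n)}} (ℕ.*-monoʳ-≤ 1 m≤n))

module EulerProduct where
  open import Data.Rational as ℚ using (ℚ; 0ℚ; 1ℚ; _+_; _*_; _≤_; _<_; nonNegative)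
  open import Algebra.Structures using (IsCommutativeRing)
  open import Data.List.Membership.Propositional.Properties using (∈-++⁺ˡ; ∈-++⁺ʳ)
  open import Data.Rational.Solver using (module +-*-Solver)
  open +-*-Solver using (solve; _:+_; _:*_; _:=_; con)
  open import Algebra.Bundles using (CommutativeMonoid)
  open import Algebra.Properties.CommutativeSemigroup
    (CommutativeMonoid.commutativeSemigroup ℚ.*-1-commutativeMonoid)
    using (interchange; x∙yz≈y∙xz; x∙yz≈yx∙z)
  open Primes using (prime>1; factorOut; divisor≢0; no-prime-divisor⇒≡1; ∣n!; prime∣n!⇒≤;
                     primesIn; primesIn-sound; primesIn-complete; primesIn-decreasing)
  open DivisorFunctions using (σ; σ-product)
  open NaturalFractions

  open DivisorSums (IsCommutativeRing.isCommutativeSemiring ℚ.+-*-isCommutativeRing)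
    using (sumTo; divisorSum; when; sumTo-cong; sumTo-split; divisorSum-cong; divisorSum-*ˡ; divisorSum-split)

  2*n≡n+n : ∀ n → 2 ℕ.* n ≡ n ℕ.+ n
  2*n≡n+n n = cong (n ℕ.+_) (ℕ.+-identityʳ n)

  sumTo-mono-≤ : ∀ n {f g} → (∀ {d} → 1 ℕ.≤ d → d ℕ.≤ n → f d ≤ g d) → sumTo n f ≤ sumTo n g
  sumTo-mono-≤ zero    f≤g = ℚ.≤-refl
  sumTo-mono-≤ (suc n) f≤g =
    ℚ.+-mono-≤ (sumTo-mono-≤ n (λ 1≤d d≤n → f≤g 1≤d (ℕ.m≤n⇒m≤1+n d≤n))) (f≤g (s≤s z≤n) ℕ.≤-refl)

  sumTo-nonNeg : ∀ n {f} → (∀ d → 0ℚ ≤ f d) → 0ℚ ≤ sumTo n f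
  sumTo-nonNeg zero    f≥0 = ℚ.≤-refl
  sumTo-nonNeg (suc n) f≥0 = ℚ.+-mono-≤ (sumTo-nonNeg n f≥0) (f≥0 (suc n))

  sumTo-const : ∀ n x → sumTo n (λ _ → x) ≡ ι n * x
  sumTo-const zero    x = sym (ℚ.*-zeroˡ x)
  sumTo-const (suc n) x = begin
    sumTo n (λ _ → x) + x  ≡⟨ cong (_+ x) (sumTo-const n x) ⟩
    ι n * x + x            ≡⟨ solve 2 (λ a b → a :* b :+ b := (con 1ℚ :+ a) :* b) refl (ι n) x ⟩
    (1ℚ + ι n) * x         ∎
    where open ≡-Reasoning

  sumTo-≤-extend : ∀ {m n f} → (∀ d → 0ℚ ≤ f d) → m ℕ.≤ n → sumTo m f ≤ sumTo n f
  sumTo-≤-extend {m} {n} {f} f≥0 m≤n = begin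
    sumTo m f                                        ≡⟨ ℚ.+-identityʳ (sumTo m f) ⟨
    sumTo m f + 0ℚ                                   ≤⟨ ℚ.+-monoʳ-≤ (sumTo m f) tail≥0 ⟩
    sumTo m f + sumTo (n ℕ.∸ m) (λ j → f (m ℕ.+ j))  ≡⟨ sumTo-split m (n ℕ.∸ m) f ⟨
    sumTo (m ℕ.+ (n ℕ.∸ m)) f                        ≡⟨ cong (λ k → sumTo k f) (ℕ.m+[n∸m]≡n m≤n) ⟩
    sumTo n f                                        ∎
    where
    open ℚ.≤-Reasoning
    tail≥0 = sumTo-nonNeg (n ℕ.∸ m) (f≥0 ∘ (m ℕ.+_))

  ∏ : (ℕ → ℚ) → List ℕ → ℚ
  ∏ f []       = 1ℚ
  ∏ f (p ∷ ps) = f p * ∏ f ps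

  ∏-++ : ∀ f xs ys → ∏ f (xs ++ ys) ≡ ∏ f xs * ∏ f ys
  ∏-++ f []       ys = sym (ℚ.*-identityˡ (∏ f ys))
  ∏-++ f (x ∷ xs) ys = trans (cong (f x *_) (∏-++ f xs ys)) (sym (ℚ.*-assoc (f x) (∏ f xs) (∏ f ys)))

  ∏-nonNeg : ∀ {f} ps → (∀ p → 0ℚ ≤ f p) → 0ℚ ≤ ∏ f ps
  ∏-nonNeg []       f≥0 = ℚ.nonNegative⁻¹ 1ℚ
  ∏-nonNeg (p ∷ ps) f≥0 = *-nonNeg (f≥0 p) (∏-nonNeg ps f≥0)

  ∏-mono-≤ : ∀ {f g ps} → (∀ p → 0ℚ ≤ f p) → All (λ p → f p ≤ g p) ps → ∏ f ps ≤ ∏ g ps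
  ∏-mono-≤             f≥0 []                 = ℚ.≤-refl
  ∏-mono-≤ {f} {ps = p ∷ ps} f≥0 (fp≤gp ∷ f≤g) =
    *-mono-≤-nonNeg (∏-nonNeg ps f≥0) (ℚ.≤-trans (f≥0 p) fp≤gp) fp≤gp (∏-mono-≤ f≥0 f≤g)

  ∏-square : ∀ f ps → ∏ (λ p → f p * f p) ps ≡ ∏ f ps * ∏ f ps
  ∏-square f []       = sym (ℚ.*-identityˡ 1ℚ)
  ∏-square f (p ∷ ps) = trans (cong (f p * f p *_) (∏-square f ps))
    (interchange (f p) (f p) (∏ f ps) (∏ f ps))

  ∏-÷ : ∀ g ps → ∏ (λ p → g p ÷ p) ps ≡ product (map g ps) ÷ product ps
  ∏-÷ g []       = sym (ι*inv 1)
  ∏-÷ g (p ∷ ps) = begin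
    g p ÷ p * ∏ (λ p → g p ÷ p) ps   ≡⟨ cong (g p ÷ p *_) (∏-÷ g ps) ⟩
    ι (g p) * inv p * (ι G * inv P)  ≡⟨ interchange (ι (g p)) (inv p) (ι G) (inv P) ⟩
    ι (g p) * ι G * (inv p * inv P)  ≡⟨ cong₂ _*_ (ι-* (g p) G) (inv-* p P) ⟨
    (g p ℕ.* G) ÷ (p ℕ.* P)          ∎
    where
    open ≡-Reasoning
    G = product (map g ps)
    P = product ps

  eulerFactor : ℕ → ℚ
  eulerFactor p = p ÷ (p ℕ.∸ 1)

  eulerProduct : List ℕ → ℚ
  eulerProduct = ∏ eulerFactor

  eulerProduct-nonNeg : ∀ ps → 0ℚ ≤ eulerProduct ps
  eulerProduct-nonNeg ps = ∏-nonNeg ps (λ p → ÷-nonNeg p (p ℕ.∸ 1))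

  1≤eulerFactor : ∀ {p} → 1 ℕ.< p → 1ℚ ≤ eulerFactor p
  1≤eulerFactor {suc zero} (s≤s ())
  1≤eulerFactor {suc (suc k)} _ = subst (_≤ eulerFactor (2 ℕ.+ k)) (ι*inv 1)
    (÷-mono-≤ 1 1 (2 ℕ.+ k) (suc k)
      (subst₂ ℕ._≤_ (sym (ℕ.*-identityˡ (suc k))) (sym (ℕ.*-identityʳ (2 ℕ.+ k))) (ℕ.n≤1+n (suc k))))

  eulerFactor≤2 : ∀ {p} → 1 ℕ.< p → eulerFactor p ≤ ι 2
  eulerFactor≤2 {suc zero} (s≤s ())
  eulerFactor≤2 {suc (suc k)} _ = subst (eulerFactor (2 ℕ.+ k) ≤_) (n÷1≡ι 2)
    (÷-mono-≤ (2 ℕ.+ k) (suc k) 2 1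
      (subst₂ ℕ._≤_ (sym (ℕ.*-identityʳ (2 ℕ.+ k))) (sym (double k)) (ℕ.m≤m+n (2 ℕ.+ k) k)))
    where
    double : ∀ k → 2 ℕ.* (1 ℕ.+ k) ≡ 2 ℕ.+ k ℕ.+ k
    double = solve-∀

  1+inv*eulerFactor : ∀ {p} → 1 ℕ.< p → 1ℚ + inv p * eulerFactor p ≡ eulerFactor p
  1+inv*eulerFactor {suc zero} (s≤s ())
  1+inv*eulerFactor {p@(suc q@(suc k))} _ = begin
    1ℚ + inv p * (ι p * inv q)  ≡⟨ cong (1ℚ +_) (x∙yz≈yx∙z (inv p) (ι p) (inv q)) ⟩
    1ℚ + ι p * inv p * inv q    ≡⟨ cong (λ x → 1ℚ + x * inv q) (ι*inv p) ⟩
    1ℚ + 1ℚ * inv q             ≡⟨ cong (_+ 1ℚ * inv q) (ι*inv q) ⟨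
    ι q * inv q + 1ℚ * inv q    ≡⟨ solve 2 (λ a b → a :* b :+ con 1ℚ :* b := (con 1ℚ :+ a) :* b) refl (ι q) (inv q) ⟩
    ι p * inv q                 ∎
    where open ≡-Reasoning

  eulerFactor≤square : ∀ {p} → 1 ℕ.< p → eulerFactor p ≤ suc p ÷ p * (suc p ÷ p)
  eulerFactor≤square {suc zero} (s≤s ())
  eulerFactor≤square {p@(suc q@(suc k))} _ = begin
    p ÷ q                                    ≤⟨ ÷-mono-≤ p q (suc p ℕ.* suc p) (p ℕ.* p) p³≤[1+p]²[p-1] ⟩
    (suc p ℕ.* suc p) ÷ (p ℕ.* p)            ≡⟨ cong₂ _*_ (ι-* (suc p) (suc p)) (inv-* p p) ⟩
    ι (suc p) * ι (suc p) * (inv p * inv p)  ≡⟨ interchange (ι (suc p)) (ι (suc p)) (inv p) (inv p) ⟩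
    suc p ÷ p * (suc p ÷ p)                  ∎
    where
    open ℚ.≤-Reasoning
    instance
      p²≢0 : NonZero (p ℕ.* p)
      p²≢0 = ℕ.m*n≢0 p p
    cube-gap : ∀ k → (2 ℕ.+ k) ℕ.* ((2 ℕ.+ k) ℕ.* (2 ℕ.+ k)) ℕ.+ (1 ℕ.+ 3 ℕ.* k ℕ.+ k ℕ.* k)
                   ≡ (3 ℕ.+ k) ℕ.* (3 ℕ.+ k) ℕ.* (1 ℕ.+ k)
    cube-gap = solve-∀
    p³≤[1+p]²[p-1] : p ℕ.* (p ℕ.* p) ℕ.≤ suc p ℕ.* suc p ℕ.* q
    p³≤[1+p]²[p-1] = subst (p ℕ.* (p ℕ.* p) ℕ.≤_) (cube-gap k) (ℕ.m≤m+n _ _)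

  σ₋₁ : ℕ → ℚ
  σ₋₁ = divisorSum inv

  harmonic : ℕ → ℚ
  harmonic n = sumTo n inv

  when-nonNeg : ∀ {P : Set} (P? : Dec P) {x} → 0ℚ ≤ x → 0ℚ ≤ when P? x
  when-nonNeg (yes _) x≥0 = x≥0
  when-nonNeg (no  _) _   = ℚ.≤-refl

  σ₋₁-nonNeg : ∀ n → 0ℚ ≤ σ₋₁ n
  σ₋₁-nonNeg n = sumTo-nonNeg n (λ d → when-nonNeg (d ∣? n) (inv-nonNeg d))

  σ₋₁-p^e*m≤ : ∀ {p m} → Prime p → ¬ p ∣ m → .{{_ : NonZero m}} →
    ∀ e → σ₋₁ (p ℕ.^ e ℕ.* m) ≤ eulerFactor p * σ₋₁ m
  σ₋₁-p^e*m≤ {p} {m} p-prime p∤m zero = begin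
    σ₋₁ (1 ℕ.* m)          ≡⟨ cong σ₋₁ (ℕ.*-identityˡ m) ⟩
    σ₋₁ m                  ≡⟨ ℚ.*-identityˡ (σ₋₁ m) ⟨
    1ℚ * σ₋₁ m             ≤⟨ ℚ.*-monoʳ-≤-nonNeg (σ₋₁ m) {{nonNegative (σ₋₁-nonNeg m)}} (1≤eulerFactor (prime>1 p-prime)) ⟩
    eulerFactor p * σ₋₁ m  ∎
    where open ℚ.≤-Reasoning
  σ₋₁-p^e*m≤ {p} {m} p-prime p∤m (suc e) = begin
    σ₋₁ (p ℕ.* p ℕ.^ e ℕ.* m)
      ≡⟨ cong σ₋₁ (ℕ.*-assoc p (p ℕ.^ e) m) ⟩
    σ₋₁ (p ℕ.* K)
      ≡⟨ divisorSum-split e inv p-prime p∤m ⟩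
    divisorSum (λ d → inv (p ℕ.* d)) K + σ₋₁ m
      ≡⟨ cong (_+ σ₋₁ m) (divisorSum-cong K (λ {d} _ → inv-* p d)) ⟩
    divisorSum (λ d → inv p * inv d) K + σ₋₁ m
      ≡⟨ cong (_+ σ₋₁ m) (divisorSum-*ˡ (inv p) K inv) ⟩
    inv p * σ₋₁ K + σ₋₁ m
      ≤⟨ ℚ.+-monoˡ-≤ (σ₋₁ m) (ℚ.*-monoˡ-≤-nonNeg (inv p) {{nonNegative (inv-nonNeg p)}} IH) ⟩
    inv p * (eulerFactor p * σ₋₁ m) + σ₋₁ m
      ≡⟨ regroup (inv p) (eulerFactor p) (σ₋₁ m) ⟩
    (1ℚ + inv p * eulerFactor p) * σ₋₁ m
      ≡⟨ cong (_* σ₋₁ m) (1+inv*eulerFactor (prime>1 p-prime)) ⟩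
    eulerFactor p * σ₋₁ m ∎
    where
    open ℚ.≤-Reasoning
    K = p ℕ.^ e ℕ.* m
    IH : σ₋₁ K ≤ eulerFactor p * σ₋₁ m
    IH = σ₋₁-p^e*m≤ p-prime p∤m e
    regroup : ∀ a b c → a * (b * c) + c ≡ (1ℚ + a * b) * c
    regroup = solve 3 (λ a b c → a :* (b :* c) :+ c := (con 1ℚ :+ a :* b) :* c) refl

  σ₋₁≤eulerProduct : ∀ {ps} → All Prime ps → ∀ n .{{_ : NonZero n}} →
    (∀ {r} → Prime r → r ∣ n → r ∈ ps) → σ₋₁ n ≤ eulerProduct ps
  σ₋₁≤eulerProduct [] n factors∈[] = ℚ.≤-reflexive (cong σ₋₁ (no-prime-divisor⇒≡1 n no-prime-divisor))
    where
    no-prime-divisor : ∀ {r} → Prime r → ¬ r ∣ n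
    no-prime-divisor r-prime r∣n with () ← factors∈[] r-prime r∣n
  σ₋₁≤eulerProduct {p ∷ ps} (p-prime ∷ ps-prime) n factors∈p∷ps with factorOut p-prime n
  ... | e , m , n≡p^e*m , p∤m = begin
    σ₋₁ n                            ≡⟨ cong σ₋₁ n≡p^e*m ⟩
    σ₋₁ (p ℕ.^ e ℕ.* m)              ≤⟨ σ₋₁-p^e*m≤ p-prime p∤m e ⟩
    eulerFactor p * σ₋₁ m            ≤⟨ ℚ.*-monoˡ-≤-nonNeg (eulerFactor p) {{nonNegative (÷-nonNeg p (p ℕ.∸ 1))}} IH ⟩
    eulerFactor p * eulerProduct ps  ∎
    where
    open ℚ.≤-Reasoning
    m∣n : m ∣ n
    m∣n = subst (m ∣_) (sym n≡p^e*m) (n∣m*n (p ℕ.^ e))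
    instance
      m≢0 : NonZero m
      m≢0 = divisor≢0 m∣n
    factors∈ps : ∀ {r} → Prime r → r ∣ m → r ∈ ps
    factors∈ps r-prime r∣m with factors∈p∷ps r-prime (∣-trans r∣m m∣n)
    ... | here refl  = ⊥-elim (p∤m r∣m)
    ... | there r∈ps = r∈ps
    IH : σ₋₁ m ≤ eulerProduct ps
    IH = σ₋₁≤eulerProduct ps-prime m factors∈ps

  harmonic≤σ₋₁ : ∀ Y {n} .{{_ : NonZero n}} → (∀ {d} → 1 ℕ.≤ d → d ℕ.≤ Y → d ∣ n) →
    harmonic Y ≤ σ₋₁ n
  harmonic≤σ₋₁ zero    {n} _         = σ₋₁-nonNeg n
  harmonic≤σ₋₁ Y@(suc _) {n} divides-n = begin
    sumTo Y inv                            ≡⟨ sumTo-cong Y (λ 1≤d d≤Y → counted (divides-n 1≤d d≤Y)) ⟩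
    sumTo Y (λ d → when (d ∣? n) (inv d))  ≤⟨ sumTo-≤-extend (λ d → when-nonNeg (d ∣? n) (inv-nonNeg d)) Y≤n ⟩
    σ₋₁ n                                  ∎
    where
    open ℚ.≤-Reasoning
    counted : ∀ {d} → d ∣ n → inv d ≡ when (d ∣? n) (inv d)
    counted {d} d∣n with d ∣? n
    ... | yes _   = refl
    ... | no  d∤n = ⊥-elim (d∤n d∣n)
    Y≤n : Y ℕ.≤ n
    Y≤n = ∣⇒≤ (divides-n (s≤s z≤n) ℕ.≤-refl)

  harmonic≤eulerProduct : ∀ Y {ps} → All Prime ps → (∀ {r} → Prime r → r ℕ.≤ Y → r ∈ ps) →
    harmonic Y ≤ eulerProduct ps
  harmonic≤eulerProduct Y ps-prime primes≤Y∈ps = ℚ.≤-trans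
    (harmonic≤σ₋₁ Y {Y ℕ.!} {{Y ℕ.!≢0}} ∣n!)
    (σ₋₁≤eulerProduct ps-prime (Y ℕ.!) {{Y ℕ.!≢0}} (λ r-prime → primes≤Y∈ps r-prime ∘ prime∣n!⇒≤ Y r-prime))

  inv2≤sumTo-inv[n+i] : ∀ n .{{_ : NonZero n}} → inv 2 ≤ sumTo n (λ i → inv (n ℕ.+ i))
  inv2≤sumTo-inv[n+i] n = begin
    inv 2                          ≡⟨ half ⟨
    ι n * inv (n ℕ.+ n)            ≡⟨ sumTo-const n (inv (n ℕ.+ n)) ⟨
    sumTo n (λ _ → inv (n ℕ.+ n))  ≤⟨ sumTo-mono-≤ n inv[n+n]≤inv[n+i] ⟩
    sumTo n (λ i → inv (n ℕ.+ i))  ∎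
    where
    open ℚ.≤-Reasoning
    inv[n+n]≤inv[n+i] : ∀ {i} → 1 ℕ.≤ i → i ℕ.≤ n → inv (n ℕ.+ n) ≤ inv (n ℕ.+ i)
    inv[n+n]≤inv[n+i] {i} 1≤i i≤n =
      inv-antitone {{ℕ.>-nonZero (ℕ.<-≤-trans 1≤i (ℕ.m≤n+m i n))}} (ℕ.+-monoʳ-≤ n i≤n)
    half : ι n * inv (n ℕ.+ n) ≡ inv 2
    half = begin-equality
      ι n * inv (n ℕ.+ n)    ≡⟨ cong (λ k → ι n * inv k) (2*n≡n+n n) ⟨
      ι n * inv (2 ℕ.* n)    ≡⟨ cong (ι n *_) (inv-* 2 n) ⟩
      ι n * (inv 2 * inv n)  ≡⟨ x∙yz≈y∙xz (ι n) (inv 2) (inv n) ⟩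
      inv 2 * (ι n * inv n)  ≡⟨ cong (inv 2 *_) (ι*inv n) ⟩
      inv 2 * 1ℚ             ≡⟨ ℚ.*-identityʳ (inv 2) ⟩
      inv 2                  ∎

  j÷2≤harmonic[2^j] : ∀ j → j ÷ 2 ≤ harmonic (2 ℕ.^ j)
  j÷2≤harmonic[2^j] zero    = subst (_≤ harmonic 1) (sym (ℚ.*-zeroˡ (inv 2))) (sumTo-nonNeg 1 inv-nonNeg)
  j÷2≤harmonic[2^j] (suc j) = begin
    (1ℚ + ι j) * inv 2                          ≡⟨ distrib (ι j) (inv 2) ⟩
    j ÷ 2 + inv 2                               ≤⟨ ℚ.+-mono-≤ (j÷2≤harmonic[2^j] j) (inv2≤sumTo-inv[n+i] N {{ℕ.m^n≢0 2 j}}) ⟩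
    harmonic N + sumTo N (λ i → inv (N ℕ.+ i))  ≡⟨ sumTo-split N N inv ⟨
    harmonic (N ℕ.+ N)                          ≡⟨ cong harmonic (2*n≡n+n N) ⟨
    harmonic (2 ℕ.^ suc j)                      ∎
    where
    open ℚ.≤-Reasoning
    N = 2 ℕ.^ j
    distrib : ∀ a b → (1ℚ + a) * b ≡ a * b + b
    distrib = solve 2 (λ a b → (con 1ℚ :+ a) :* b := a :* b :+ b) refl

  eulerProduct≤square : ∀ {ps} → All (1 ℕ.<_) ps →
    eulerProduct ps ≤ ∏ (λ p → suc p ÷ p) ps * ∏ (λ p → suc p ÷ p) ps
  eulerProduct≤square {ps} ps>1 = ℚ.≤-trans
    (∏-mono-≤ (λ p → ÷-nonNeg p (p ℕ.∸ 1)) (All.map eulerFactor≤square ps>1))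
    (ℚ.≤-reflexive (∏-square (λ p → suc p ÷ p) ps))

  eulerProduct[primesIn0M]≤2^M : ∀ M → eulerProduct (primesIn 0 M) ≤ ι (2 ℕ.^ M)
  eulerProduct[primesIn0M]≤2^M zero    = ℚ.≤-refl
  eulerProduct[primesIn0M]≤2^M (suc M) with 0 ℕ.<? suc M ×-dec prime? (suc M)
  ... | yes (_ , 1+M-prime) = begin
    eulerFactor (suc M) * eulerProduct (primesIn 0 M)
      ≤⟨ *-mono-≤-nonNeg (eulerProduct-nonNeg (primesIn 0 M)) (ι-nonNeg 2)
                         (eulerFactor≤2 (prime>1 1+M-prime)) (eulerProduct[primesIn0M]≤2^M M) ⟩
    ι 2 * ι (2 ℕ.^ M)  ≡⟨ ι-* 2 (2 ℕ.^ M) ⟨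
    ι (2 ℕ.^ suc M)    ∎
    where open ℚ.≤-Reasoning
  ... | no  _ = ℚ.≤-trans (eulerProduct[primesIn0M]≤2^M M) (ι-mono-≤ (ℕ.m≤m+n (2 ℕ.^ M) _))

  x²<y²⇒x<y : ∀ {x y} → 0ℚ ≤ y → x * x < y * y → x < y
  x²<y²⇒x<y {x} {y} 0≤y x²<y² with x ℚ.<? y
  ... | yes x<y = x<y
  ... | no  x≮y = ⊥-elim (ℚ.<-irrefl refl (ℚ.<-≤-trans x²<y² y²≤x²))
    where
    y≤x = ℚ.≮⇒≥ x≮y
    y²≤x² = *-mono-≤-nonNeg 0≤y (ℚ.≤-trans 0≤y y≤x) y≤x y≤x

  σ-unbounded : ∀ K M → ∃ λ Y → K ℕ.* product (primesIn M Y) ℕ.< σ (product (primesIn M Y))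
  σ-unbounded K M = Y , <÷⇒*< {K} {P} {σ P} K<ρ
    where
    c = 2 ℕ.^ M
    N = K ℕ.* K ℕ.* c
    -- harmonic (2 ^ j) ≥ j / 2, so this Y makes the harmonic sum exceed N = K² 2^M
    Y = 2 ℕ.^ (2 ℕ.* suc N)
    large = primesIn M Y
    small = primesIn 0 M
    large-prime : All Prime large
    large-prime = All.map proj₁ (primesIn-sound M Y)
    small-prime : All Prime small
    small-prime = All.map proj₁ (primesIn-sound 0 M)
    P = product large
    instance
      P≢0 : NonZero P
      P≢0 = productOfPrimes≢0 large-prime
    ρ = σ P ÷ P
    ρ-nonNeg : 0ℚ ≤ ρ
    ρ-nonNeg = ÷-nonNeg (σ P) P
    large≤ρ² : eulerProduct large ≤ ρ * ρ
    large≤ρ² = subst (λ x → eulerProduct large ≤ x * x)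
      (trans (∏-÷ suc large) (cong (_÷ P) (sym (σ-product large-prime (primesIn-decreasing M Y)))))
      (eulerProduct≤square (All.map prime>1 large-prime))
    primes≤Y : ∀ {r} → Prime r → r ℕ.≤ Y → r ∈ large ++ small
    primes≤Y {r} r-prime r≤Y with M ℕ.<? r
    ... | yes M<r = ∈-++⁺ˡ (primesIn-complete Y r-prime M<r r≤Y)
    ... | no  M≮r = ∈-++⁺ʳ large (primesIn-complete M r-prime (ℕ.<-trans (s≤s z≤n) (prime>1 r-prime)) (ℕ.≮⇒≥ M≮r))
    bound : ι (suc N) ≤ ρ * ρ * ι c
    bound = begin
      ι (suc N)                                ≡⟨ [k*n]÷k≡ι-n 2 (suc N) ⟨
      (2 ℕ.* suc N) ÷ 2                        ≤⟨ j÷2≤harmonic[2^j] (2 ℕ.* suc N) ⟩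
      harmonic Y                               ≤⟨ harmonic≤eulerProduct Y (All.++⁺ large-prime small-prime) primes≤Y ⟩
      eulerProduct (large ++ small)            ≡⟨ ∏-++ eulerFactor large small ⟩
      eulerProduct large * eulerProduct small  ≤⟨ *-mono-≤-nonNeg (eulerProduct-nonNeg small) (*-nonNeg ρ-nonNeg ρ-nonNeg)
                                                                  large≤ρ² (eulerProduct[primesIn0M]≤2^M M) ⟩
      ρ * ρ * ι c                              ∎
      where open ℚ.≤-Reasoning
    K<ρ : ι K < ρ
    K<ρ = x²<y²⇒x<y ρ-nonNeg (ℚ.*-cancelʳ-<-nonNeg (ι c) {{nonNegative (ι-nonNeg c)}} (begin-strict
      ι K * ι K * ι c  ≡⟨ trans (ι-* (K ℕ.* K) c) (cong (_* ι c) (ι-* K K)) ⟨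
      ι N              <⟨ ι-mono-< (ℕ.n<1+n N) ⟩
      ι (suc N)        ≤⟨ bound ⟩
      ρ * ρ * ι c      ∎))
      where open ℚ.≤-Reasoning

module Descent (α β γ δ : ℕ) .{{_ : NonZero β}} (αδ<γβ : α ℕ.* δ ℕ.< γ ℕ.* β) where
  open import Data.Nat using (_+_; _*_; _≤_; _<_; _>_; _<?_)
  open DivisorFunctions using (σ; σ≤Ss+n; Ss-*-prime; SsRatioBetween)
  open Primes using (prime∤product; primesIn; primesIn-sound; primesIn-decreasing)
  open EulerProduct using (σ-unbounded)

  threshold : ℕ
  threshold = 3 * α * δ + δ * β

  -- With S = Ss A and B = σ A ≤ S + A, the ratio Ss (q * A) / (q * A) = ((2 + q) S + B) / (q A)
  -- is at most (1 + 3/q) S/A + 1/q; for S/A ≤ α/β this stays below γ/δ once q exceeds the threshold.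
  step-bound : ∀ {q S A B} → threshold < q → .{{NonZero A}} → S * β ≤ α * A → B ≤ S + A →
    ((2 + q) * S + B) * δ < γ * (q * A)
  step-bound {q} {S} {A} {B} threshold<q Sβ≤αA B≤S+A = ℕ.*-cancelʳ-< β _ _ (begin-strict
    ((2 + q) * S + B) * δ * β          ≤⟨ ℕ.*-monoˡ-≤ β (ℕ.*-monoˡ-≤ δ (ℕ.+-monoʳ-≤ ((2 + q) * S) B≤S+A)) ⟩
    ((2 + q) * S + (S + A)) * δ * β    ≡⟨ expand q S A δ β ⟩
    (3 + q) * δ * (S * β) + A * δ * β  ≤⟨ ℕ.+-monoˡ-≤ (A * δ * β) (ℕ.*-monoʳ-≤ ((3 + q) * δ) Sβ≤αA) ⟩
    (3 + q) * δ * (α * A) + A * δ * β  ≡⟨ collect q α A δ β ⟩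
    A * (q * (α * δ) + threshold)      <⟨ ℕ.*-monoʳ-< A (ℕ.+-monoʳ-< (q * (α * δ)) threshold<q) ⟩
    A * (q * (α * δ) + q)              ≡⟨ cong (A *_) (trans (ℕ.*-suc q (α * δ)) (ℕ.+-comm q _)) ⟨
    A * (q * suc (α * δ))              ≤⟨ ℕ.*-monoʳ-≤ A (ℕ.*-monoʳ-≤ q αδ<γβ) ⟩
    A * (q * (γ * β))                  ≡⟨ reorder A q γ β ⟩
    γ * (q * A) * β                    ∎)
    where
    open ℕ.≤-Reasoning
    expand : ∀ q S A δ β → ((2 + q) * S + (S + A)) * δ * β ≡ (3 + q) * δ * (S * β) + A * δ * β
    expand = solve-∀
    collect : ∀ q α A δ β → (3 + q) * δ * (α * A) + A * δ * β ≡ A * (q * (α * δ) + (3 * α * δ + δ * β))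
    collect = solve-∀
    reorder : ∀ A q γ β → A * (q * (γ * β)) ≡ γ * (q * A) * β
    reorder = solve-∀

  descend : ∀ qs → All Prime qs → AllPairs _>_ qs → All (threshold <_) qs →
    α * product qs < Ss (product qs) * β → ∃ (SsRatioBetween α β γ δ)
  descend [] [] [] [] ()
  descend (q ∷ qs) (q-prime ∷ qs-prime) (qs<q ∷ qs-decreasing) (q-large ∷ qs-large) below
    with α * product qs <? Ss (product qs) * β
  ... | yes below′ = descend qs qs-prime qs-decreasing qs-large below′
  ... | no  ¬below′ = q * A , below , above
    where
    A = product qs
    instance
      A≢0 : NonZero A
      A≢0 = productOfPrimes≢0 qs-prime
    above : Ss (q * A) * δ < γ * (q * A)
    above = subst (λ x → x * δ < γ * (q * A)) (sym (Ss-*-prime q-prime (prime∤product q-prime qs-prime qs<q)))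
      (step-bound q-large (ℕ.≮⇒≥ ¬below′) (σ≤Ss+n A))

  window-from-large-primes : ∀ Y → let P = product (primesIn threshold Y) in
    suc α * P < σ P → ∃ (SsRatioBetween α β γ δ)
  window-from-large-primes Y [1+α]P<σP = descend (primesIn threshold Y)
    (All.map proj₁ (primesIn-sound threshold Y)) (primesIn-decreasing threshold Y)
    (All.map (proj₁ ∘ proj₂) (primesIn-sound threshold Y)) αP<SsPβ
    where
    P = product (primesIn threshold Y)
    αP<SsP : α * P < Ss P
    αP<SsP = ℕ.+-cancelˡ-< P (α * P) (Ss P) (begin-strict
      P + α * P  <⟨ [1+α]P<σP ⟩
      σ P        ≤⟨ σ≤Ss+n P ⟩
      Ss P + P   ≡⟨ ℕ.+-comm (Ss P) P ⟩
      P + Ss P   ∎)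
      where open ℕ.≤-Reasoning
    αP<SsPβ : α * P < Ss P * β
    αP<SsPβ = ℕ.<-≤-trans αP<SsP (ℕ.m≤m*n (Ss P) β)

  Ss-window : ∃ (SsRatioBetween α β γ δ)
  Ss-window = uncurry window-from-large-primes (σ-unbounded (suc α) threshold)

module CrossMultiplication where
  open DivisorFunctions using (SsRatioBetween)
  open import Data.Integer.Base as ℤ using (+_; -[1+_]; +<+)
  import Data.Integer.Properties as ℤ
  open import Data.Rational.Base as ℚ using (ℚ; mkℚ; 0ℚ; _≤_; _<_; _/_; toℚᵘ)
  import Data.Rational.Properties as ℚ
  open import Data.Rational.Unnormalised.Base as ℚᵘ using (mkℚᵘ; *<*)
  import Data.Rational.Unnormalised.Properties as ℚᵘ

  nonNeg-fraction : ∀ p → 0ℚ ≤ p → ∃₂ λ x y → p ≡ + x / suc y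
  nonNeg-fraction p@(mkℚ (+ x) y _) _ = x , y , sym (ℚ.↥p/↧p≡p p)
  nonNeg-fraction (mkℚ -[1+ _ ] _ _) 0≤p with () ← ℚ.nonNegative 0≤p

  toℚᵘ-/ : ∀ x y → toℚᵘ (+ x / suc y) ℚᵘ.≃ mkℚᵘ (+ x) y
  toℚᵘ-/ x y = ℚ.toℚᵘ-fromℚᵘ (mkℚᵘ (+ x) y)

  /<⇒*< : ∀ x y z w → + x / suc y < + z / suc w → x ℕ.* suc w ℕ.< z ℕ.* suc y
  /<⇒*< x y z w x/y<z/w
    with *<* xw<zy ← ℚᵘ.<-respʳ-≃ (toℚᵘ-/ z w) (ℚᵘ.<-respˡ-≃ (toℚᵘ-/ x y) (ℚ.toℚᵘ-mono-< x/y<z/w)) =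
    ℤ.drop‿+<+ (subst₂ ℤ._<_ (sym (ℤ.pos-* x (suc w))) (sym (ℤ.pos-* z (suc y))) xw<zy)

  *<⇒/< : ∀ x y z w → x ℕ.* suc w ℕ.< z ℕ.* suc y → + x / suc y < + z / suc w
  *<⇒/< x y z w xw<zy = ℚ.toℚᵘ-cancel-<
    (ℚᵘ.<-respʳ-≃ (ℚᵘ.≃-sym (toℚᵘ-/ z w)) (ℚᵘ.<-respˡ-≃ (ℚᵘ.≃-sym (toℚᵘ-/ x y))
      (*<* (subst₂ ℤ._<_ (ℤ.pos-* x (suc w)) (ℤ.pos-* z (suc y)) (+<+ xw<zy)))))

  ratio-between : ∀ α β-1 γ δ-1 → ∃ (SsRatioBetween α (suc β-1) γ (suc δ-1)) →
    ∃[ m ] (+ α / suc β-1 < ratio m × ratio m < + γ / suc δ-1)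
  ratio-between α β-1 γ δ-1 (zero  , ()    , _)
  ratio-between α β-1 γ δ-1 (suc m , above , below) =
    m , *<⇒/< α β-1 (Ss (suc m)) m above , *<⇒/< (Ss (suc m)) m γ δ-1 below

open CrossMultiplication using (nonNeg-fraction; /<⇒*<; ratio-between)
open import Data.Rational using (ℚ; 0ℚ; _≤_; _<_)

theorem3p2 : (a b : ℚ) → 0ℚ ≤ a → a < b →
    ∃[ m ] (a < ratio m × ratio m < b)
theorem3p2 a b 0≤a a<b
  with α , β-1 , refl ← nonNeg-fraction a 0≤a
     | γ , δ-1 , refl ← nonNeg-fraction b (ℚ.≤-trans 0≤a (ℚ.<⇒≤ a<b))
  = ratio-between α β-1 γ δ-1 (Descent.Ss-window α (suc β-1) γ (suc δ-1) (/<⇒*< α β-1 γ δ-1 a<b))
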